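{- Let $n \ge k \ge 2$ be integers. There exists a $k$-dicritical digraph with exactly $n$ vertices.
   Context: Digraphs are finite, without loops and parallel arcs (digons allowed). A dicolouring colours vertices so that each colour class induces an acyclic subdigraph; $G$ is $k$-dicritical if its dichromatic number is $k$ and every proper subdigraph has smaller dichromatic number. -}

module Defs where

open import Data.Nat using (ℕ; zero; suc; _<_; _≤_; _∸_)
open import Data.Fin using (Fin)
open import Data.Bool using (Bool; true; false; T)
open import Data.List using (List; []; _∷_; _++_; [_])
open import Data.List.Relation.Unary.All using (All)
open import Data.List.Relation.Unary.Linked using (Linked)
open import Data.List.Relation.Unary.Unique.Propositional using (Unique)
open import Data.Product using (Σ; _×_; ∃-syntax)
open import Data.Sum using (_⊎_)
open import Relation.Nullary using (¬_)
open import Relation.Binary.PropositionalEquality using (_≡_)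
open import Function.Definitions using (Injective)

-- A (finite) digraph on vertex set Fin n: arc u v = true iff there is an arc u → v.
-- Being a relation, there are no parallel arcs; digons (u→v and v→u) are allowed.
record Digraph (n : ℕ) : Set where
  field
    arc      : Fin n → Fin n → Bool
    loopless : ∀ v → arc v v ≡ false
open Digraph public

IsDirectedCycle : ∀ {n} → Digraph n → Fin n → List (Fin n) → Set
IsDirectedCycle G v vs =
  Unique (v ∷ vs) × Linked (λ a b → T (arc G a b)) ((v ∷ vs) ++ [ v ])

-- A c-dicolouring: each colour class induces an acyclic subdigraph, i.e.
-- no directed cycle is monochromatic.
IsDicolouring : ∀ {n} → Digraph n → (c : ℕ) → (Fin n → Fin c) → Set
IsDicolouring {n} G c col =
  ∀ (v : Fin n) (vs : List (Fin n)) → IsDirectedCycle G v vs →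
  ¬ All (λ u → col u ≡ col v) vs

Dicolourable : ∀ {n} → Digraph n → ℕ → Set
Dicolourable {n} G c = Σ (Fin n → Fin c) (IsDicolouring G c)

HasDichromaticNumber : ∀ {n} → Digraph n → ℕ → Set
HasDichromaticNumber G k = Dicolourable G k × ¬ Dicolourable G (k ∸ 1)

record SubdigraphVia {m n : ℕ} (H : Digraph m) (G : Digraph n) (f : Fin m → Fin n) : Set where
  field
    injective : Injective _≡_ _≡_ f
    arcs⊆     : ∀ u v → T (arc H u v) → T (arc G (f u) (f v))

ProperVia : ∀ {m n} → Digraph m → Digraph n → (Fin m → Fin n) → Set
ProperVia {m} {n} H G f =
  m < n ⊎ (∃[ u ] ∃[ v ] (T (arc G (f u) (f v)) × ¬ T (arc H u v)))

Dicritical : ∀ {n} → ℕ → Digraph n → Set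
Dicritical {n} k G =
  HasDichromaticNumber G k ×
  (∀ (m : ℕ) (H : Digraph m) (f : Fin m → Fin n) →
     SubdigraphVia H G f → ProperVia H G f → Dicolourable H (k ∸ 1))

-- For k = q + 2 and n = q + t + 2, take G to be the directed join of the complete digraph
-- on q vertices with a directed cycle of length t + 2.  A clique vertex forms a digon with
-- every other vertex, so a (q + 1)-dicolouring would give the clique q private colours and
-- leave one colour for the whole cycle, which is impossible; two colours on the cycle give
-- a (q + 2)-dicolouring.  As every vertex has an out-arc, criticality reduces to
-- (q + 1)-dicolouring G minus a single arc.  Each of these colourings is certified by a
-- rank that strictly increases along every remaining monochromatic arc, which excludes
-- monochromatic directed cycles.
module Submission where

open import Defs
open import Data.Nat using (ℕ; _≤_)
open import Data.Product using (∃-syntax)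

open import Data.Nat using (zero; suc; _+_; _<_; z≤n; s≤s; s≤s⁻¹; _<?_)
import Data.Nat as ℕ
open import Data.Nat.Properties
  using (<-irrefl; <-trans; ≤-trans; <⇒≱; 1+n≰n; n<1+n; m<n⇒m<1+n; ≤∧≮⇒≡; ≤∧≢⇒<; m≤n+m; +-suc;
         m≤n⇒∃[o]m+o≡n)
open import Data.Fin using (Fin; zero; suc; toℕ; fromℕ; fromℕ<; inject₁; splitAt; _≟_)
import Data.Fin as Fin
open import Data.Fin.Properties
  using (toℕ-injective; toℕ≤pred[n]; toℕ-fromℕ; toℕ-fromℕ<; toℕ-inject₁; splitAt-join; join-splitAt;
         suc-injective; pigeonhole; injective⇒≤; all?; any?; ¬∀⟶∃¬)
open import Data.Bool using (T; false)
open import Data.List using ([]; _∷_; _++_; [_]; tabulate)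
open import Data.List.Relation.Unary.All using (All; []; _∷_)
import Data.List.Relation.Unary.All.Properties as All
open import Data.List.Relation.Unary.Linked using (Linked; []; [-]; _∷_)
open import Data.List.Relation.Unary.Linked.Properties using (Linked⇒AllPairs)
open import Data.List.Relation.Unary.AllPairs using ([]; _∷_)
import Data.List.Relation.Unary.Unique.Propositional.Properties as Unique
open import Data.Product using (Σ-syntax; _×_; _,_; proj₁; proj₂)
import Data.Product as Product
open import Data.Sum using (_⊎_; inj₁; inj₂; [_,_]′)
import Data.Sum as Sum
open import Data.Sum.Properties using (inj₁-injective; inj₂-injective)
open import Data.Empty using (⊥; ⊥-elim)
open import Function using (_∘_; id)
open import Function.Definitions using (Injective)
open import Relation.Nullary using (¬_; Dec; yes; no; contradiction)
open import Relation.Nullary.Decidable using (isYes; toWitness; fromWitness; ¬?)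
open import Relation.Binary.PropositionalEquality using (_≡_; _≢_; refl; sym; trans; cong; subst; subst₂)

-- Rank certificates

RankedExcept : {V : Set} {c : ℕ} → (V → V → Set) → (V → V → Set) → (V → Fin c) → (V → ℕ) → Set
RankedExcept R E col r = ∀ {a b} → R a b → col a ≡ col b → E a b ⊎ r a < r b

DicolourableWithout : {V : Set} → (V → V → Set) → ℕ → V → V → Set
DicolourableWithout {V} R c x y =
  Σ[ col ∈ (V → Fin c) ] Σ[ r ∈ (V → ℕ) ] RankedExcept R (λ a b → a ≡ x × b ≡ y) col r

rankedExcept-comap : ∀ {V W : Set} {c} {R E : V → V → Set} {R′ E′ : W → W → Set}
                     {col : V → Fin c} {r : V → ℕ} (g : W → V) →
                     (∀ {a b} → R′ a b → R (g a) (g b)) →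
                     (∀ {a b} → R′ a b → E (g a) (g b) → E′ a b) →
                     RankedExcept R E col r → RankedExcept R′ E′ (col ∘ g) (r ∘ g)
rankedExcept-comap g hom exempt ranked a eq = Sum.map₁ (exempt a) (ranked (hom a) eq)

ascent-not-closed : ∀ {V : Set} (r : V → ℕ) v vs → ¬ Linked (λ a b → r a < r b) (v ∷ vs ++ [ v ])
ascent-not-closed r v vs ascent with rv<rest ∷ _ ← Linked⇒AllPairs <-trans ascent
  with rv<rv ∷ [] ← All.++⁻ʳ vs rv<rest = <-irrefl refl rv<rv

ranked⇒isDicolouring : ∀ {n c} (G : Digraph n) {col : Fin n → Fin c} {r : Fin n → ℕ} →
                       RankedExcept (λ u v → T (arc G u v)) (λ _ _ → ⊥) col r →
                       IsDicolouring G c col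
ranked⇒isDicolouring G {col} {r} ranked v vs (_ , closed) mono =
  ascent-not-closed r v vs (ascending closed (refl ∷ All.++⁺ mono (refl ∷ [])))
  where
  ascending : ∀ {us} → Linked (λ a b → T (arc G a b)) us → All (λ u → col u ≡ col v) us →
              Linked (λ a b → r a < r b) us
  ascending [] [] = []
  ascending [-] _ = [-]
  ascending (a ∷ as) (p ∷ ps@(q ∷ _)) = [ ⊥-elim , id ]′ (ranked a (trans p (sym q))) ∷ ascending as ps

dicolouring-separates-digon : ∀ {n c} (G : Digraph n) {col : Fin n → Fin c} → IsDicolouring G c col →
                              ∀ {u v} → T (arc G u v) → T (arc G v u) → col u ≢ col v
dicolouring-separates-digon G dc {u} {v} uv vu eq =
  dc u (v ∷ []) (((u≢v ∷ []) ∷ [] ∷ []) , (uv ∷ vu ∷ [-])) (sym eq ∷ [])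
  where
  u≢v : u ≢ v
  u≢v refl = subst T (loopless G u) uv

<⇒∃-notInImage : ∀ {m n} → m < n → (f : Fin m → Fin n) → ∃[ w ] ∀ i → f i ≢ w
<⇒∃-notInImage {m} {n} m<n f with all? (λ w → any? (λ i → f i ≟ w))
... | yes surjective = ⊥-elim (<⇒≱ m<n (injective⇒≤ section-injective))
  where
  section-injective : Injective _≡_ _≡_ (proj₁ ∘ surjective)
  section-injective {w} {w′} eq =
    trans (sym (proj₂ (surjective w))) (trans (cong f eq) (proj₂ (surjective w′)))
... | no ¬surjective =
  Product.map₂ (λ ¬hit i eq → ¬hit (i , eq)) (¬∀⟶∃¬ n _ (λ w → any? (λ i → f i ≟ w)) ¬surjective)

proper-subdigraphs-dicolourable :
  ∀ {n c} (G : Digraph n) →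
  (∀ u → ∃[ v ] T (arc G u v)) →
  (∀ {x y} → T (arc G x y) → DicolourableWithout (λ u v → T (arc G u v)) c x y) →
  ∀ (m : ℕ) (H : Digraph m) (f : Fin m → Fin n) → SubdigraphVia H G f → ProperVia H G f → Dicolourable H c
proper-subdigraphs-dicolourable {c = c} G out-arc arc-critical m H f sub = avoiding
  where
  open SubdigraphVia sub
  pullback : ∀ {x y} → DicolourableWithout (λ u v → T (arc G u v)) c x y →
             (∀ {a b} → T (arc H a b) → ¬ (f a ≡ x × f b ≡ y)) → Dicolourable H c
  pullback {x} {y} (col , r , ranked) misses =
    col ∘ f ,
    ranked⇒isDicolouring H
      (rankedExcept-comap {R = λ u v → T (arc G u v)} {E = λ a b → a ≡ x × b ≡ y} f (arcs⊆ _ _) misses ranked)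

  avoiding : ProperVia H G f → Dicolourable H c
  avoiding (inj₂ (u , v , uv∈G , uv∉H)) = pullback (arc-critical uv∈G)
    λ ab (p , q) → uv∉H (subst₂ (λ a b → T (arc H a b)) (injective p) (injective q) ab)
  avoiding (inj₁ m<n) with w , w∉f ← <⇒∃-notInImage m<n f with v , wv ← out-arc w =
    pullback (arc-critical wv) λ _ (p , _) → w∉f _ p

-- The directed cycle 0 → 1 → ⋯ → ℓ → 0

data CycleStep (ℓ : ℕ) : ℕ → ℕ → Set where
  next : ∀ {a} → CycleStep ℓ a (suc a)
  wrap : CycleStep ℓ ℓ 0

cycleStep? : ∀ ℓ a b → Dec (CycleStep ℓ a b)
cycleStep? ℓ a b with b ℕ.≟ suc a
... | yes refl = yes next
... | no b≢1+a with a ℕ.≟ ℓ | b ℕ.≟ 0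
...   | yes refl | yes refl = yes wrap
...   | no a≢ℓ   | _        = no λ { next → b≢1+a refl ; wrap → a≢ℓ refl }
...   | _        | no b≢0   = no λ { next → b≢1+a refl ; wrap → b≢0 refl }

cycleStep-irreflexive : ∀ {ℓ a} → ¬ CycleStep (suc ℓ) a a
cycleStep-irreflexive ()

cycleStep-functional : ∀ {ℓ a b b′} → b ≤ ℓ → b′ ≤ ℓ → CycleStep ℓ a b → CycleStep ℓ a b′ → b ≡ b′
cycleStep-functional _   _    next next = refl
cycleStep-functional b≤ℓ _    next wrap = ⊥-elim (1+n≰n b≤ℓ)
cycleStep-functional _   b′≤ℓ wrap next = ⊥-elim (1+n≰n b′≤ℓ)
cycleStep-functional _   _    wrap wrap = refl

cycleStep-ascending : ∀ {ℓ a b} → CycleStep ℓ a (suc b) → a < suc b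
cycleStep-ascending next = n<1+n _

-- The position of a when the cycle is traversed starting just after c.
rankAfter : ℕ → ℕ → ℕ → ℕ
rankAfter ℓ c a with c <? a
... | yes _ = a
... | no _  = a + suc ℓ

rankAfter-ascending : ∀ {ℓ c a b} → c ≤ ℓ → a ≢ c → CycleStep ℓ a b → rankAfter ℓ c a < rankAfter ℓ c b
rankAfter-ascending {c = c} {a} _ a≢c next with c <? a | c <? suc a
... | yes _   | yes _     = n<1+n a
... | yes c<a | no c≮1+a  = contradiction (m<n⇒m<1+n c<a) c≮1+a
... | no c≮a  | yes c<1+a = contradiction (sym (≤∧≮⇒≡ (s≤s⁻¹ c<1+a) c≮a)) a≢c
... | no _    | no _      = n<1+n _
rankAfter-ascending {ℓ} {c} c≤ℓ ℓ≢c wrap with c <? ℓ | c <? 0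
... | _       | yes ()
... | yes _   | no _ = n<1+n ℓ
... | no c≮ℓ  | no _ = contradiction (≤∧≢⇒< c≤ℓ (ℓ≢c ∘ sym)) c≮ℓ

rankAfter-positive : ∀ ℓ c a → 0 < rankAfter ℓ c a
rankAfter-positive ℓ c a with c <? a
... | yes c<a = ≤-trans (s≤s z≤n) c<a
... | no _    = ≤-trans (s≤s z≤n) (m≤n+m (suc ℓ) a)

CycleArc : ∀ {t} → Fin (2 + t) → Fin (2 + t) → Set
CycleArc {t} j j′ = CycleStep (suc t) (toℕ j) (toℕ j′)

cycleArc-next : ∀ {t} (i : Fin (suc t)) → CycleArc (inject₁ i) (suc i)
cycleArc-next i = subst (λ a → CycleStep _ a (suc (toℕ i))) (sym (toℕ-inject₁ i)) next

cycleArc-wrap : ∀ {t} → CycleArc (fromℕ (suc t)) zero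
cycleArc-wrap {t} = subst (λ a → CycleStep (suc t) a 0) (sym (toℕ-fromℕ (suc t))) wrap

cycleArc-successor : ∀ {t} (j : Fin (2 + t)) → ∃[ j′ ] CycleArc j j′
cycleArc-successor {t} j with toℕ j <? suc t
... | yes j<ℓ = fromℕ< (s≤s j<ℓ) , subst (CycleStep (suc t) (toℕ j)) (sym (toℕ-fromℕ< (s≤s j<ℓ))) next
... | no j≮ℓ  = zero , subst (λ a → CycleStep (suc t) a 0) (sym (≤∧≮⇒≡ (toℕ≤pred[n] j) j≮ℓ)) wrap

cycleArc-functional : ∀ {t} {j j′ j″ : Fin (2 + t)} → CycleArc j j′ → CycleArc j j″ → j′ ≡ j″
cycleArc-functional {j′ = j′} {j″} s s′ =
  toℕ-injective (cycleStep-functional (toℕ≤pred[n] j′) (toℕ≤pred[n] j″) s s′)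

linked-tabulate-++ : ∀ {A : Set} {R : A → A → Set} {n} (f : Fin (suc n) → A) {y} →
                     (∀ i → R (f (inject₁ i)) (f (suc i))) → R (f (fromℕ n)) y →
                     Linked R (tabulate f ++ [ y ])
linked-tabulate-++ {n = zero}  f step last = last ∷ [-]
linked-tabulate-++ {n = suc n} f step last = step zero ∷ linked-tabulate-++ (f ∘ suc) (step ∘ suc) last

-- Directed joins

data Join {A B : Set} (R : A → A → Set) (S : B → B → Set) : A ⊎ B → A ⊎ B → Set where
  left       : ∀ {a a′} → R a a′ → Join R S (inj₁ a) (inj₁ a′)
  right      : ∀ {b b′} → S b b′ → Join R S (inj₂ b) (inj₂ b′)
  left→right : ∀ {a b} → Join R S (inj₁ a) (inj₂ b)
  right→left : ∀ {a b} → Join R S (inj₂ b) (inj₁ a)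

module _ {A B : Set} {R : A → A → Set} {S : B → B → Set} where

  join? : (∀ a a′ → Dec (R a a′)) → (∀ b b′ → Dec (S b b′)) → ∀ x y → Dec (Join R S x y)
  join? R? S? (inj₁ a) (inj₁ a′) with R? a a′
  ... | yes r = yes (left r)
  ... | no ¬r = no λ { (left r) → ¬r r }
  join? R? S? (inj₂ b) (inj₂ b′) with S? b b′
  ... | yes s = yes (right s)
  ... | no ¬s = no λ { (right s) → ¬s s }
  join? R? S? (inj₁ _) (inj₂ _) = yes left→right
  join? R? S? (inj₂ _) (inj₁ _) = yes right→left

  join-irreflexive : (∀ a → ¬ R a a) → (∀ b → ¬ S b b) → ∀ x → ¬ Join R S x x
  join-irreflexive R-irr S-irr (inj₁ a) (left r)  = R-irr a r
  join-irreflexive R-irr S-irr (inj₂ b) (right s) = S-irr b s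

digraph : ∀ {n} (R : Fin n → Fin n → Set) → (∀ u v → Dec (R u v)) → (∀ u → ¬ R u u) → Digraph n
digraph R R? irr = record { arc = λ u v → isYes (R? u v) ; loopless = loopless′ }
  where
  loopless′ : ∀ u → isYes (R? u u) ≡ false
  loopless′ u with R? u u
  ... | yes r = ⊥-elim (irr u r)
  ... | no _  = refl

module CliqueJoinCycle (q t : ℕ) where

  V : Set
  V = Fin q ⊎ Fin (2 + t)

  Arc : V → V → Set
  Arc = Join _≢_ CycleArc

  G : Digraph (q + (2 + t))
  G = digraph (λ u v → Arc (splitAt q u) (splitAt q v))
              (λ u v → arc? (splitAt q u) (splitAt q v))
              (λ u → join-irreflexive (λ i i≢i → i≢i refl) (λ j → cycleStep-irreflexive) (splitAt q u))
    where
    arc? : ∀ a b → Dec (Arc a b)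
    arc? = join? (λ i i′ → ¬? (i ≟ i′)) (λ j j′ → cycleStep? _ (toℕ j) (toℕ j′))

  vertex : V → Fin (q + (2 + t))
  vertex = Fin.join q (2 + t)

  vertex-injective : ∀ {a b} → vertex a ≡ vertex b → a ≡ b
  vertex-injective {a} {b} eq =
    trans (sym (splitAt-join q _ a)) (trans (cong (splitAt q) eq) (splitAt-join q _ b))

  splitAt-injective : ∀ {u v} → splitAt q u ≡ splitAt q v → u ≡ v
  splitAt-injective {u} {v} eq =
    trans (sym (join-splitAt q _ u)) (trans (cong vertex eq) (join-splitAt q _ v))

  arc⇒Arc : ∀ {u v} → T (arc G u v) → Arc (splitAt q u) (splitAt q v)
  arc⇒Arc = toWitness

  Arc⇒arc : ∀ {u v} → Arc (splitAt q u) (splitAt q v) → T (arc G u v)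
  Arc⇒arc = fromWitness

  Arc⇒vertex-arc : ∀ {a b} → Arc a b → T (arc G (vertex a) (vertex b))
  Arc⇒vertex-arc {a} {b} ab =
    Arc⇒arc (subst₂ Arc (sym (splitAt-join q _ a)) (sym (splitAt-join q _ b)) ab)

  successor : ∀ a → ∃[ b ] Arc a b
  successor (inj₁ _) = inj₂ zero , left→right
  successor (inj₂ j) = Product.map inj₂ right (cycleArc-successor j)

  out-arc : ∀ u → ∃[ v ] T (arc G u v)
  out-arc u with b , ab ← successor (splitAt q u) =
    vertex b , Arc⇒arc (subst (Arc (splitAt q u)) (sym (splitAt-join q _ b)) ab)

  dicolourable : Dicolourable G (2 + q)
  dicolourable =
    colour ∘ splitAt q ,
    ranked⇒isDicolouring G (rankedExcept-comap {R = Arc} {E = λ _ _ → ⊥} (splitAt q) arc⇒Arc (λ _ → id) ranked)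
    where
    colour : V → Fin (2 + q)
    colour (inj₁ i)       = suc (suc i)
    colour (inj₂ zero)    = zero
    colour (inj₂ (suc _)) = suc zero

    rank : V → ℕ
    rank (inj₁ _) = 0
    rank (inj₂ j) = toℕ j

    ranked : RankedExcept Arc (λ _ _ → ⊥) colour rank
    ranked (left i≢i′) eq = ⊥-elim (i≢i′ (suc-injective (suc-injective eq)))
    ranked (left→right {_} {zero})  ()
    ranked (left→right {_} {suc _}) ()
    ranked (right→left {_} {zero})  ()
    ranked (right→left {_} {suc _}) ()
    ranked (right {zero}  {zero}  s) _ = ⊥-elim (cycleStep-irreflexive s)
    ranked (right {zero}  {suc _} _) ()
    ranked (right {suc _} {zero}  _) ()
    ranked (right {suc _} {suc _} s) _ = inj₂ (cycleStep-ascending s)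

  module _ {c : Fin (q + (2 + t)) → Fin (suc q)} (dc : IsDicolouring G (suc q) c) where
    private
      colour : V → Fin (suc q)
      colour = c ∘ vertex

      pick : Fin (2 + t) → Fin (2 + q) → V
      pick _ zero          = inj₂ zero
      pick j (suc zero)    = inj₂ j
      pick _ (suc (suc i)) = inj₁ i

    clique-separated : ∀ i b → inj₁ i ≢ b → colour (inj₁ i) ≢ colour b
    clique-separated i b i≢b =
      dicolouring-separates-digon G dc (Arc⇒vertex-arc (digon b i≢b)) (Arc⇒vertex-arc (digon′ b i≢b))
      where
      digon : ∀ b → inj₁ i ≢ b → Arc (inj₁ i) b
      digon (inj₁ i′) i≢i′ = left (i≢i′ ∘ cong inj₁)
      digon (inj₂ _)  _    = left→right
      digon′ : ∀ b → inj₁ i ≢ b → Arc b (inj₁ i)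
      digon′ (inj₁ i′) i≢i′ = left (i≢i′ ∘ cong inj₁ ∘ sym)
      digon′ (inj₂ _)  _    = right→left

    cycle-monochromatic : ∀ j → colour (inj₂ j) ≡ colour (inj₂ zero)
    cycle-monochromatic j with pigeonhole (n<1+n (suc q)) (colour ∘ pick j)
    ... | zero , suc zero , _ , eq = sym eq
    ... | a , suc (suc i) , a<b , eq = ⊥-elim (clique-separated i _ (distinct a a<b) (sym eq))
      where
      distinct : ∀ a → toℕ a < suc (suc (toℕ i)) → inj₁ i ≢ pick j a
      distinct zero _ ()
      distinct (suc zero) _ ()
      distinct (suc (suc i′)) a<b eq = <-irrefl (cong toℕ (inj₁-injective (sym eq))) (s≤s⁻¹ (s≤s⁻¹ a<b))
    ... | zero , zero , () , _
    ... | suc zero , zero , () , _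
    ... | suc zero , suc zero , s≤s () , _
    ... | suc (suc _) , zero , () , _
    ... | suc (suc _) , suc zero , s≤s () , _

  ¬dicolourable : ¬ Dicolourable G (suc q)
  ¬dicolourable (c , dc) = dc (vertex (inj₂ zero)) (tabulate (vertex ∘ inj₂ ∘ suc)) directed-cycle
                             (All.tabulate⁺ (cycle-monochromatic dc ∘ suc))
    where
    directed-cycle : IsDirectedCycle G (vertex (inj₂ zero)) (tabulate (vertex ∘ inj₂ ∘ suc))
    directed-cycle =
      Unique.tabulate⁺ (inj₂-injective ∘ vertex-injective) ,
      linked-tabulate-++ (vertex ∘ inj₂) (Arc⇒vertex-arc ∘ right ∘ cycleArc-next) (Arc⇒vertex-arc (right cycleArc-wrap))

  module CliqueArcDeleted {x y : Fin q} (x≢y : x ≢ y) where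
    private
      merge : Fin q → Fin q
      merge i with i ≟ y
      ... | yes _ = x
      ... | no _  = i

      merge-avoids : ∀ i → merge i ≢ y
      merge-avoids i with i ≟ y
      ... | yes _   = x≢y
      ... | no i≢y = i≢y

      merge-fibre : ∀ {i i′} → i ≢ i′ → merge i ≡ merge i′ → (i ≡ x × i′ ≡ y) ⊎ (i ≡ y × i′ ≡ x)
      merge-fibre {i} {i′} i≢i′ eq with i ≟ y | i′ ≟ y
      ... | yes refl | yes refl = ⊥-elim (i≢i′ refl)
      ... | yes refl | no _     = inj₂ (refl , sym eq)
      ... | no _     | yes refl = inj₁ (eq , refl)
      ... | no _     | no _     = ⊥-elim (i≢i′ eq)

      colour : V → Fin (suc q)
      colour (inj₁ i)       = suc (merge i)
      colour (inj₂ zero)    = suc y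
      colour (inj₂ (suc _)) = zero

      rank : V → ℕ
      rank (inj₁ i) with i ≟ x
      ... | yes _ = 1
      ... | no _  = 0
      rank (inj₂ j) = toℕ j

      rank-y<x : rank (inj₁ y) < rank (inj₁ x)
      rank-y<x with y ≟ x | x ≟ x
      ... | yes y≡x | _       = ⊥-elim (x≢y (sym y≡x))
      ... | no _    | yes _   = s≤s z≤n
      ... | no _    | no x≢x = ⊥-elim (x≢x refl)

      ranked : RankedExcept Arc (λ a b → a ≡ inj₁ x × b ≡ inj₁ y) colour rank
      ranked (left i≢i′) eq with merge-fibre i≢i′ (suc-injective eq)
      ... | inj₁ (refl , refl) = inj₁ (refl , refl)
      ... | inj₂ (refl , refl) = inj₂ rank-y<x
      ranked (left→right {i} {zero})  eq = ⊥-elim (merge-avoids i (suc-injective eq))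
      ranked (left→right {_} {suc _}) ()
      ranked (right→left {i} {zero})  eq = ⊥-elim (merge-avoids i (suc-injective (sym eq)))
      ranked (right→left {_} {suc _}) ()
      ranked (right {zero}  {zero}  s) _ = ⊥-elim (cycleStep-irreflexive s)
      ranked (right {zero}  {suc _} _) ()
      ranked (right {suc _} {zero}  _) ()
      ranked (right {suc _} {suc _} s) _ = inj₂ (cycleStep-ascending s)

    deleted : DicolourableWithout Arc (suc q) (inj₁ x) (inj₁ y)
    deleted = colour , rank , ranked

  module CycleArcDeleted {x y : Fin (2 + t)} (xy : CycleArc x y) where
    private
      colour : V → Fin (suc q)
      colour (inj₁ i) = suc i
      colour (inj₂ _) = zero

      rank : V → ℕ
      rank (inj₁ _) = 0
      rank (inj₂ j) = rankAfter (suc t) (toℕ x) (toℕ j)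

      ranked : RankedExcept Arc (λ a b → a ≡ inj₂ x × b ≡ inj₂ y) colour rank
      ranked (left i≢i′) eq = ⊥-elim (i≢i′ (suc-injective eq))
      ranked left→right ()
      ranked right→left ()
      ranked (right {j} s) _ with j ≟ x
      ... | yes refl = inj₁ (refl , cong inj₂ (cycleArc-functional s xy))
      ... | no j≢x   = inj₂ (rankAfter-ascending (toℕ≤pred[n] x) (j≢x ∘ toℕ-injective) s)

    deleted : DicolourableWithout Arc (suc q) (inj₂ x) (inj₂ y)
    deleted = colour , rank , ranked

  -- w takes the colour of z; the rank α of the clique is chosen so that the arc of the
  -- digon z ↔ w that is not deleted ascends.
  module CrossArcDeleted (z : Fin q) (w : Fin (2 + t)) where
    private
      colour : V → Fin (suc q)
      colour (inj₁ i) = suc i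
      colour (inj₂ j) with j ≟ w
      ... | yes _ = suc z
      ... | no _  = zero

      rank : ℕ → V → ℕ
      rank α (inj₁ _) = α
      rank α (inj₂ j) = rankAfter (suc t) (toℕ w) (toℕ j)

      Digon : V → V → Set
      Digon a b = (a ≡ inj₁ z × b ≡ inj₂ w) ⊎ (a ≡ inj₂ w × b ≡ inj₁ z)

      ranked : ∀ α → RankedExcept Arc Digon colour (rank α)
      ranked α (left i≢i′) eq = ⊥-elim (i≢i′ (suc-injective eq))
      ranked α (left→right {i} {j}) eq with j ≟ w
      ... | yes refl = inj₁ (inj₁ (cong inj₁ (suc-injective eq) , refl))
      ranked α (left→right {i} {j}) () | no _
      ranked α (right→left {i} {j}) eq with j ≟ w
      ... | yes refl = inj₁ (inj₂ (refl , cong inj₁ (suc-injective (sym eq))))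
      ranked α (right→left {i} {j}) () | no _
      ranked α (right {j} {j′} s) eq with j ≟ w | j′ ≟ w
      ... | yes refl | yes refl = ⊥-elim (cycleStep-irreflexive s)
      ranked α (right {j} {j′} s) () | yes _ | no _
      ranked α (right {j} {j′} s) () | no _ | yes _
      ... | no j≢w | no _ = inj₂ (rankAfter-ascending (toℕ≤pred[n] w) (j≢w ∘ toℕ-injective) s)

    forward-deleted : DicolourableWithout Arc (suc q) (inj₁ z) (inj₂ w)
    forward-deleted = colour , rank α , λ ab eq →
      [ [ inj₁ , (λ { (refl , refl) → inj₂ (n<1+n _) }) ]′ , inj₂ ]′ (ranked α ab eq)
      where
      α = suc (rankAfter (suc t) (toℕ w) (toℕ w))

    backward-deleted : DicolourableWithout Arc (suc q) (inj₂ w) (inj₁ z)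
    backward-deleted = colour , rank 0 , λ ab eq →
      [ [ (λ { (refl , refl) → inj₂ (rankAfter-positive (suc t) (toℕ w) (toℕ w)) }) , inj₁ ]′ , inj₂ ]′ (ranked 0 ab eq)

  arc-deleted : ∀ {a b} → Arc a b → DicolourableWithout Arc (suc q) a b
  arc-deleted (left x≢y)             = CliqueArcDeleted.deleted x≢y
  arc-deleted (right xy)             = CycleArcDeleted.deleted xy
  arc-deleted (left→right {z} {w})   = CrossArcDeleted.forward-deleted z w
  arc-deleted (right→left {z} {w})   = CrossArcDeleted.backward-deleted z w

  arc-critical : ∀ {u v} → T (arc G u v) → DicolourableWithout (λ u v → T (arc G u v)) (suc q) u v
  arc-critical {u} {v} uv with colour , rank , ranked ← arc-deleted (arc⇒Arc uv) =
    colour ∘ splitAt q , rank ∘ splitAt q ,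
    rankedExcept-comap {R = Arc} {E = λ a b → a ≡ splitAt q u × b ≡ splitAt q v}
      (splitAt q) arc⇒Arc (λ _ → Product.map splitAt-injective splitAt-injective) ranked

  dicritical : Dicritical (2 + q) G
  dicritical = (dicolourable , ¬dicolourable) , proper-subdigraphs-dicolourable G out-arc arc-critical

lemma3p4 : (n k : ℕ) → 2 ≤ k → k ≤ n → ∃[ G ] Dicritical {n} k G
lemma3p4 n (suc (suc q)) (s≤s (s≤s z≤n)) k≤n with t , refl ← m≤n⇒∃[o]m+o≡n k≤n =
  subst (λ n → ∃[ G ] Dicritical {n} (2 + q) G) (trans (+-suc q (suc t)) (cong suc (+-suc q t)))
    (CliqueJoinCycle.G q t , CliqueJoinCycle.dicritical q t)
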